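{- For all finite lists $\bm{\alpha}$ (possibly empty) and $\bm{\pi}$ (non-empty) of elements of $\{0,1\}$, there exists a strictly increasing sequence $\gamma:\mathbb{N}^{+}\to\mathbb{N}^{+}$ such that $(\|\bm{\alpha},\bm{\pi}\|,\gamma)$ is an actual event and $$\mathbb{P}(\|\bm{\alpha},\bm{\pi}\|,\gamma)=_{\mathbb{R}}\frac{\sum_{k=1}^{\ell(\bm{\pi})}\pi_{k}}{\ell(\bm{\pi})}.$$
   Context: The setting is constructive (Bishop-style) mathematics. A potential event is a sequence $\mathsf{e}:\mathbb{N}^{+}\to\{0,1\}$; two potential events are equal ($=_{\mathcal{P}}$) if they agree at every $n\in\mathbb{N}^{+}$. For a potential event $\mathsf{e}$ define the rational sequence $\Phi(\mathsf{e})(n)=\frac{\sum_{i=1}^{n}\mathsf{e}(i)}{n}$, $n\in\mathbb{N}^{+}$. An actual event is a pair $(\mathsf{e},\gamma)$ where $\mathsf{e}$ is a potential event and $\gamma:\mathbb{N}^{+}\to\mathbb{N}^{+}$ is strictly increasing, such that $|\Phi(\mathsf{e})(\gamma(n)+i)-\Phi(\mathsf{e})(\gamma(n)+j)|\le \frac1n$ for all $n\in\mathbb{N}^{+}$, $i,j\in\mathbb{N}$. A Bishop real is a sequence $x:\mathbb{N}^{+}\to\mathbb{Q}$ with $|x(n)-x(m)|\le\frac1n+\frac1m$ for all $n,m$; Bishop reals $x,y$ are equal ($=_{\mathbb{R}}$) iff $|x(n)-y(n)|\le \frac2n$ for all $n$; a rational $q$ is identified with the constant sequence $q$. For an actual event,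 $\mathbb{P}(\mathsf{e},\gamma):=\Phi(\mathsf{e})\circ\gamma$ (a Bishop real). For finite lists $\bm{\alpha}$ and $\bm{\pi}$ over $\{0,1\}$ with lengths $\ell(\bm{\alpha})\ge 0$ and $\ell(\bm{\pi})>0$, the potential event $\|\bm{\alpha},\bm{\pi}\|$ is defined by $\|\bm{\alpha},\bm{\pi}\|(i)=\alpha_i$ if $1\le i\le\ell(\bm{\alpha})$ and $\|\bm{\alpha},\bm{\pi}\|(i)=\pi_{\mathsf{rm}(i-\ell(\bm{\alpha})-1,\ell(\bm{\pi}))+1}$ if $i>\ell(\bm{\alpha})$, where $\alpha_i,\pi_i$ are the $i$-th entries and $\mathsf{rm}(a,b)$ is the remainder of $a$ divided by $b$. -}

module Defs where

open import Data.Bool using (Bool; true; false; if_then_else_)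
open import Data.Nat as ℕ using (ℕ; zero; suc; _+_; _∸_; _%_; NonZero; _<?_)
open import Data.Integer using (+_)
open import Data.Rational using (ℚ; _/_; _-_; ∣_∣; _≤_; 0ℚ)
open import Data.List using (List; length; lookup; map)
open import Data.Nat.ListAction using (sum)
open import Data.Fin using (fromℕ<)
open import Data.Product using (Σ; _×_)
open import Relation.Nullary using (yes; no)
open import Data.Nat.DivMod using (m%n<n)

-- Convention: ℕ⁺ is represented by ℕ; only arguments n ≥ 1 are ever
-- inspected by the predicates below (values at 0 are irrelevant).

PotentialEvent : Set
PotentialEvent = ℕ → Bool

bit : Bool → ℕ
bit b = if b then 1 else 0

partialSum : PotentialEvent → ℕ → ℕ
partialSum e zero    = 0
partialSum e (suc n) = partialSum e n + bit (e (suc n))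

Φ : PotentialEvent → ℕ → ℚ
Φ e zero    = 0ℚ
Φ e (suc m) = (+ partialSum e (suc m)) / suc m

1/ : (n : ℕ) → .{{NonZero n}} → ℚ
1/ n = (+ 1) / n

2/ : (n : ℕ) → .{{NonZero n}} → ℚ
2/ n = (+ 2) / n

IsSeqℕ⁺ : (ℕ → ℕ) → Set
IsSeqℕ⁺ γ = ∀ n → .{{NonZero n}} → NonZero (γ n)

StrictlyIncreasing : (ℕ → ℕ) → Set
StrictlyIncreasing γ = ∀ n m → .{{NonZero n}} → n ℕ.< m → γ n ℕ.< γ m

IsActualEvent : PotentialEvent → (ℕ → ℕ) → Set
IsActualEvent e γ =
  IsSeqℕ⁺ γ × StrictlyIncreasing γ ×
  (∀ n → .{{_ : NonZero n}} → ∀ (i j : ℕ) →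
     ∣ Φ e (γ n + i) - Φ e (γ n + j) ∣ ≤ 1/ n)

ℙ : PotentialEvent → (ℕ → ℕ) → (ℕ → ℚ)
ℙ e γ n = Φ e (γ n)

-- Bishop real equality  x =ℝ y  :  |x(n) - y(n)| ≤ 2/n for all n ≥ 1
_=ℝ_ : (ℕ → ℚ) → (ℕ → ℚ) → Set
x =ℝ y = ∀ n → .{{_ : NonZero n}} → ∣ x n - y n ∣ ≤ 2/ n

const : ℚ → (ℕ → ℚ)
const q _ = q

-- ‖α, π‖(i) = α_i if 1 ≤ i ≤ ℓ(α);  π_{rm(i - ℓ(α) - 1, ℓ(π)) + 1} if i > ℓ(α)
-- (entries 1-indexed on paper, 0-indexed via lookup here)
‖_,_‖ : (α π : List Bool) → .{{NonZero (length π)}} → PotentialEvent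
‖ α , π ‖ zero = false   -- dummy, position 0 is not in ℕ⁺
‖ α , π ‖ (suc k) with k <? length α
... | yes k<ℓα = lookup α (fromℕ< k<ℓα)
... | no _     = lookup π (fromℕ< (m%n<n (suc k ∸ length α ∸ 1) (length π)))

average : (π : List Bool) → .{{NonZero (length π)}} → ℚ
average π = (+ sum (map bit π)) / length π

-- After the prefix α the event repeats π, so the number S(N) of successes
-- among the first N trials stays within a constant of the expected count:
-- ∣ p·S(N) − s·N ∣ ≤ p·(ℓ(α) + p), where p = ℓ(π) and s counts the successes
-- in π. Dividing by p·N puts Φ(N) within (ℓ(α) + p)/N of s/p, so
-- γ(n) = 2·(ℓ(α) + p)·n is a modulus of convergence for Φ.

module Submission where

open import Defs
open import Data.Bool using (Bool; true; false)
open import Data.Nat as ℕ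
  using (ℕ; zero; suc; _+_; _*_; _∸_; _%_; _/_; _≤_; _<_; ∣_-_∣; NonZero; _<?_; z≤n; s≤s;
         >-nonZero; >-nonZero⁻¹)
open import Data.Nat.Properties
open import Data.Nat.DivMod using (m%n<n; m≡m%n+[m/n]*n; [m+n]%n≡m%n; m<n⇒m%n≡m)
open import Data.Nat.ListAction using (sum)
open import Data.Nat.Tactic.RingSolver using (solve-∀)
open import Data.Integer as ℤ using (+_; _⊖_)
import Data.Integer.Properties as ℤ
open import Data.Rational as ℚ using (toℚᵘ)
import Data.Rational.Properties as ℚ
import Data.Rational.Unnormalised as ℚᵘ
import Data.Rational.Unnormalised.Properties as ℚᵘ
open import Data.List using (List; []; _∷_; length; lookup; map)
open import Data.Fin using (fromℕ<)
open import Data.Fin.Properties using (fromℕ<-cong)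
open import Data.Product using (Σ; _×_; _,_)
open import Data.Sum using (inj₁; inj₂)
open import Function using (_∘_)
open import Relation.Nullary using (yes; no; contradiction)
open import Relation.Binary.PropositionalEquality

shift : ℕ → PotentialEvent → PotentialEvent
shift m e i = e (m + i)

partialSum-cong : ∀ {e e′} → (∀ i → e (suc i) ≡ e′ (suc i)) → ∀ n → partialSum e n ≡ partialSum e′ n
partialSum-cong e≗e′ zero    = refl
partialSum-cong e≗e′ (suc n) = cong₂ _+_ (partialSum-cong e≗e′ n) (cong bit (e≗e′ n))

partialSum-+ : ∀ e m n → partialSum e (m + n) ≡ partialSum e m + partialSum (shift m e) n
partialSum-+ e m zero    = trans (cong (partialSum e) (+-identityʳ m)) (sym (+-identityʳ _))
partialSum-+ e m (suc n) = begin
  partialSum e (m + suc n)                                      ≡⟨ cong (partialSum e) (+-suc m n) ⟩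
  partialSum e (m + n) + bit (e (suc (m + n)))                  ≡⟨ cong₂ _+_ (partialSum-+ e m n) (cong (bit ∘ e) (sym (+-suc m n))) ⟩
  partialSum e m + partialSum (shift m e) n + bit (e (m + suc n)) ≡⟨ +-assoc (partialSum e m) _ _ ⟩
  partialSum e m + partialSum (shift m e) (suc n)               ∎
  where open ≡-Reasoning

bit≤1 : ∀ b → bit b ≤ 1
bit≤1 true  = ≤-refl
bit≤1 false = z≤n

partialSum≤ : ∀ e n → partialSum e n ≤ n
partialSum≤ e zero    = z≤n
partialSum≤ e (suc n) = subst (partialSum e (suc n) ≤_) (+-comm n 1) (+-mono-≤ (partialSum≤ e n) (bit≤1 (e (suc n))))

Periodic : ℕ → PotentialEvent → Set
Periodic p e = ∀ i → shift p e (suc i) ≡ e (suc i)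

partialSum-periodic : ∀ {p e} → Periodic p e → ∀ q t →
  partialSum e (q * p + t) ≡ q * partialSum e p + partialSum e t
partialSum-periodic         per zero    t = refl
partialSum-periodic {p} {e} per (suc q) t = begin
  partialSum e (p + q * p + t)                         ≡⟨ cong (partialSum e) (+-assoc p (q * p) t) ⟩
  partialSum e (p + (q * p + t))                       ≡⟨ partialSum-+ e p (q * p + t) ⟩
  partialSum e p + partialSum (shift p e) (q * p + t)  ≡⟨ cong (_+_ (partialSum e p)) (partialSum-cong per (q * p + t)) ⟩
  partialSum e p + partialSum e (q * p + t)            ≡⟨ cong (_+_ (partialSum e p)) (partialSum-periodic per q t) ⟩
  partialSum e p + (q * partialSum e p + partialSum e t) ≡⟨ +-assoc (partialSum e p) _ _ ⟨
  suc q * partialSum e p + partialSum e t              ∎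
  where open ≡-Reasoning

∣m+n-o+p∣≤∣m-o∣+∣n-p∣ : ∀ m n o p → ∣ m + n - o + p ∣ ≤ ∣ m - o ∣ + ∣ n - p ∣
∣m+n-o+p∣≤∣m-o∣+∣n-p∣ m n o p = begin
  ∣ m + n - o + p ∣                   ≤⟨ ∣-∣-triangle (m + n) (o + n) (o + p) ⟩
  ∣ m + n - o + n ∣ + ∣ o + n - o + p ∣ ≡⟨ cong₂ _+_ (cong₂ ∣_-_∣ (+-comm m n) (+-comm o n)) refl ⟩
  ∣ n + m - n + o ∣ + ∣ o + n - o + p ∣ ≡⟨ cong₂ _+_ (∣m+n-m+o∣≡∣n-o∣ n m o) (∣m+n-m+o∣≡∣n-o∣ o n p) ⟩
  ∣ m - o ∣ + ∣ n - p ∣                 ∎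
  where open ≤-Reasoning

∣px-sN∣≤pN : ∀ {p s x N} → s ≤ p → x ≤ N → ∣ p * x - s * N ∣ ≤ p * N
∣px-sN∣≤pN {p} {s} {x} {N} s≤p x≤N =
  ≤-trans (∣m-n∣≤m⊔n (p * x) (s * N)) (⊔-lub (*-monoʳ-≤ p x≤N) (*-monoˡ-≤ N s≤p))

module _ {p : ℕ} {{_ : NonZero p}} {e : PotentialEvent} (per : Periodic p e) where

  private
    s = partialSum e p

  periodic-discrepancy : ∀ m → ∣ p * partialSum e m - s * m ∣ ≤ p * p
  periodic-discrepancy m = begin
    ∣ p * partialSum e m - s * m ∣                         ≡⟨ cong₂ (λ x y → ∣ p * partialSum e x - s * y ∣) m≡qp+t m≡qp+t ⟩
    ∣ p * partialSum e (q * p + t) - s * (q * p + t) ∣     ≡⟨ cong (λ x → ∣ p * x - s * (q * p + t) ∣) (partialSum-periodic per q t) ⟩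
    ∣ p * (q * s + partialSum e t) - s * (q * p + t) ∣     ≡⟨ cong₂ ∣_-_∣ (expandˡ p q s (partialSum e t)) (expandʳ p q s t) ⟩
    ∣ q * s * p + p * partialSum e t - q * s * p + s * t ∣ ≡⟨ ∣m+n-m+o∣≡∣n-o∣ (q * s * p) _ _ ⟩
    ∣ p * partialSum e t - s * t ∣                         ≤⟨ ∣px-sN∣≤pN (partialSum≤ e p) (partialSum≤ e t) ⟩
    p * t                                                  ≤⟨ *-monoʳ-≤ p (<⇒≤ (m%n<n m p)) ⟩
    p * p                                                  ∎
    where
    open ≤-Reasoning
    q = m / p
    t = m % p
    m≡qp+t : m ≡ q * p + t
    m≡qp+t = trans (m≡m%n+[m/n]*n m p) (+-comm t (q * p))
    expandˡ : ∀ p q s u → p * (q * s + u) ≡ q * s * p + p * u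
    expandˡ = solve-∀
    expandʳ : ∀ p q s t → s * (q * p + t) ≡ q * s * p + s * t
    expandʳ = solve-∀

eventually-periodic-discrepancy :
  ∀ {a p} {{_ : NonZero p}} {e} → Periodic p (shift a e) →
  ∀ N → ∣ p * partialSum e N - partialSum (shift a e) p * N ∣ ≤ p * (a + p)
eventually-periodic-discrepancy {a} {p} {e} per N with a ℕ.≤? N
... | no N<a = begin
  ∣ p * partialSum e N - s * N ∣ ≤⟨ ∣px-sN∣≤pN (partialSum≤ (shift a e) p) (partialSum≤ e N) ⟩
  p * N                          ≤⟨ *-monoʳ-≤ p (≤-trans (<⇒≤ (≰⇒> N<a)) (m≤m+n a p)) ⟩
  p * (a + p)                    ∎
  where open ≤-Reasoning
        s = partialSum (shift a e) p
... | yes a≤N = begin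
  ∣ p * partialSum e N - s * N ∣                                         ≡⟨ cong₂ (λ x y → ∣ p * partialSum e x - s * y ∣) N≡a+m N≡a+m ⟩
  ∣ p * partialSum e (a + m) - s * (a + m) ∣                             ≡⟨ cong (λ x → ∣ p * x - s * (a + m) ∣) (partialSum-+ e a m) ⟩
  ∣ p * (partialSum e a + partialSum (shift a e) m) - s * (a + m) ∣      ≡⟨ cong₂ ∣_-_∣ (*-distribˡ-+ p _ _) (*-distribˡ-+ s a m) ⟩
  ∣ p * partialSum e a + p * partialSum (shift a e) m - s * a + s * m ∣  ≤⟨ ∣m+n-o+p∣≤∣m-o∣+∣n-p∣ (p * partialSum e a) _ (s * a) _ ⟩
  ∣ p * partialSum e a - s * a ∣ + ∣ p * partialSum (shift a e) m - s * m ∣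
      ≤⟨ +-mono-≤ (∣px-sN∣≤pN (partialSum≤ (shift a e) p) (partialSum≤ e a)) (periodic-discrepancy per m) ⟩
  p * a + p * p                                                          ≡⟨ *-distribˡ-+ p a p ⟨
  p * (a + p)                                                            ∎
  where open ≤-Reasoning
        s = partialSum (shift a e) p
        m = N ∸ a
        N≡a+m : N ≡ a + m
        N≡a+m = sym (m+[n∸m]≡n a≤N)

partialSum-lookup : ∀ (π : List Bool) e →
  (∀ k (k<ℓπ : k < length π) → e (suc k) ≡ lookup π (fromℕ< k<ℓπ)) →
  partialSum e (length π) ≡ sum (map bit π)
partialSum-lookup []      e e≗π = refl
partialSum-lookup (x ∷ π) e e≗π = begin
  partialSum e (1 + length π)                  ≡⟨ partialSum-+ e 1 (length π) ⟩
  bit (e 1) + partialSum (shift 1 e) (length π) ≡⟨ cong₂ _+_ (cong bit (e≗π 0 (s≤s z≤n)))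
                                                           (partialSum-lookup π (shift 1 e) (λ k k< → e≗π (suc k) (s≤s k<))) ⟩
  bit x + sum (map bit π)                      ∎
  where open ≡-Reasoning

module _ (α π : List Bool) {{_ : NonZero (length π)}} where

  private
    a = length α
    p = length π

  ‖α,π‖-tail : ∀ k → ‖ α , π ‖ (a + suc k) ≡ lookup π (fromℕ< (m%n<n k p))
  ‖α,π‖-tail k rewrite +-suc a k with a + k <? a
  ... | yes a+k<a = contradiction a+k<a (≤⇒≯ (m≤m+n a k))
  ... | no _      = cong (lookup π) (fromℕ<-cong _ _ (cong (_% p) index) _ _)
    where
    index : suc (a + k) ∸ a ∸ 1 ≡ k
    index = trans (cong (_∸ 1) (+-∸-assoc 1 (m≤m+n a k))) (m+n∸m≡n a k)

  ‖α,π‖-periodic : Periodic p (shift a ‖ α , π ‖)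
  ‖α,π‖-periodic i = begin
    ‖ α , π ‖ (a + (p + suc i))         ≡⟨ cong (λ j → ‖ α , π ‖ (a + j)) (+-suc p i) ⟩
    ‖ α , π ‖ (a + suc (p + i))         ≡⟨ ‖α,π‖-tail (p + i) ⟩
    lookup π (fromℕ< (m%n<n (p + i) p)) ≡⟨ cong (lookup π) (fromℕ<-cong _ _ (trans (cong (_% p) (+-comm p i)) ([m+n]%n≡m%n i p)) _ _) ⟩
    lookup π (fromℕ< (m%n<n i p))       ≡⟨ ‖α,π‖-tail i ⟨
    ‖ α , π ‖ (a + suc i)               ∎
    where open ≡-Reasoning

  ‖α,π‖-period-count : partialSum (shift a ‖ α , π ‖) p ≡ sum (map bit π)
  ‖α,π‖-period-count = partialSum-lookup π (shift a ‖ α , π ‖) λ k k<p →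
    trans (‖α,π‖-tail k) (cong (lookup π) (fromℕ<-cong _ _ (m<n⇒m%n≡m k<p) _ _))

∣m⊖n∣≡∣m-n∣ : ∀ m n → ℤ.∣ m ⊖ n ∣ ≡ ∣ m - n ∣
∣m⊖n∣≡∣m-n∣ m n with ≤-total m n
... | inj₁ m≤n = trans (ℤ.∣⊖∣-≤ m≤n) (sym (m≤n⇒∣m-n∣≡n∸m m≤n))
... | inj₂ n≤m = trans (ℤ.∣m⊖n∣≡∣n⊖m∣ m n) (trans (ℤ.∣⊖∣-≤ n≤m) (sym (m≤n⇒∣n-m∣≡n∸m n≤m)))

∣m/b-n/d∣≤k/fᵘ : ∀ m b n d k f .{{_ : NonZero b}} .{{_ : NonZero d}} .{{_ : NonZero f}} →
  ∣ m * d - n * b ∣ * f ≤ k * (b * d) →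
  ℚᵘ.∣ + m ℚᵘ./ b ℚᵘ.- + n ℚᵘ./ d ∣ ℚᵘ.≤ + k ℚᵘ./ f
∣m/b-n/d∣≤k/fᵘ m b@(suc _) n d@(suc _) k f@(suc _) h = ℚᵘ.*≤* (subst₂ ℤ._≤_ lhs (ℤ.pos-* k (b * d)) (ℤ.+≤+ h))
  where
  numerator : ℤ.∣ + m ℤ.* + d ℤ.+ ℤ.- (+ n) ℤ.* + b ∣ ≡ ∣ m * d - n * b ∣
  numerator = begin
    ℤ.∣ + m ℤ.* + d ℤ.+ ℤ.- (+ n) ℤ.* + b ∣ ≡⟨ cong₂ (λ x y → ℤ.∣ x ℤ.+ y ∣) (ℤ.pos-* m d) (trans (cong ℤ.-_ (ℤ.pos-* n b)) (ℤ.neg-distribˡ-* (+ n) (+ b))) ⟨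
    ℤ.∣ + (m * d) ℤ.- + (n * b) ∣           ≡⟨ cong ℤ.∣_∣ (ℤ.[+m]-[+n]≡m⊖n (m * d) (n * b)) ⟩
    ℤ.∣ (m * d) ⊖ (n * b) ∣                 ≡⟨ ∣m⊖n∣≡∣m-n∣ (m * d) (n * b) ⟩
    ∣ m * d - n * b ∣                       ∎
    where open ≡-Reasoning
  lhs : + (∣ m * d - n * b ∣ * f) ≡ + ℤ.∣ + m ℤ.* + d ℤ.+ ℤ.- (+ n) ℤ.* + b ∣ ℤ.* + f
  lhs = trans (cong (λ x → + (x * f)) (sym numerator)) (ℤ.pos-* ℤ.∣ + m ℤ.* + d ℤ.+ ℤ.- (+ n) ℤ.* + b ∣ f)

∣m/b-n/d∣≤k/f : ∀ m b n d k f .{{_ : NonZero b}} .{{_ : NonZero d}} .{{_ : NonZero f}} →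
  ∣ m * d - n * b ∣ * f ≤ k * (b * d) →
  ℚ.∣ + m ℚ./ b ℚ.- + n ℚ./ d ∣ ℚ.≤ + k ℚ./ f
∣m/b-n/d∣≤k/f m b@(suc _) n d@(suc _) k f@(suc _) h = ℚ.toℚᵘ-cancel-≤ (begin
  toℚᵘ ℚ.∣ x ℚ.- y ∣                         ≃⟨ ℚ.toℚᵘ-homo-∣-∣ (x ℚ.- y) ⟩
  ℚᵘ.∣ toℚᵘ (x ℚ.- y) ∣                      ≃⟨ ℚᵘ.∣-∣-cong (ℚ.toℚᵘ-homo-+ x (ℚ.- y)) ⟩
  ℚᵘ.∣ toℚᵘ x ℚᵘ.+ toℚᵘ (ℚ.- y) ∣            ≃⟨ ℚᵘ.∣-∣-cong (ℚᵘ.+-cong (ℚ.toℚᵘ-fromℚᵘ (+ m ℚᵘ./ b)) (ℚᵘ.≃-trans (ℚ.toℚᵘ-homo‿- y) (ℚᵘ.-‿cong (ℚ.toℚᵘ-fromℚᵘ (+ n ℚᵘ./ d))))) ⟩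
  ℚᵘ.∣ + m ℚᵘ./ b ℚᵘ.- + n ℚᵘ./ d ∣          ≤⟨ ∣m/b-n/d∣≤k/fᵘ m b n d k f h ⟩
  + k ℚᵘ./ f                                 ≃⟨ ℚ.toℚᵘ-fromℚᵘ (+ k ℚᵘ./ f) ⟨
  toℚᵘ (+ k ℚ./ f)                           ∎)
  where
  open ℚᵘ.≤-Reasoning
  x = + m ℚ./ b
  y = + n ℚ./ d

∣xM-yN∣≤c[N+M] : ∀ p {{_ : NonZero p}} {s c x y N M} →
  ∣ p * x - s * N ∣ ≤ p * c → ∣ p * y - s * M ∣ ≤ p * c → ∣ x * M - y * N ∣ ≤ c * (N + M)
∣xM-yN∣≤c[N+M] p {s} {c} {x} {y} {N} {M} hx hy = *-cancelˡ-≤ p (begin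
  p * ∣ x * M - y * N ∣                           ≡⟨ *-distribˡ-∣-∣ p (x * M) (y * N) ⟩
  ∣ p * (x * M) - p * (y * N) ∣                   ≤⟨ ∣-∣-triangle (p * (x * M)) (s * N * M) (p * (y * N)) ⟩
  ∣ p * (x * M) - s * N * M ∣ + ∣ s * N * M - p * (y * N) ∣
      ≡⟨ cong₂ _+_ (cong (λ z → ∣ z - s * N * M ∣) (sym (*-assoc p x M))) (cong₂ ∣_-_∣ (regroup s N M) (sym (*-assoc p y N))) ⟩
  ∣ p * x * M - s * N * M ∣ + ∣ s * M * N - p * y * N ∣
      ≡⟨ cong₂ _+_ (*-distribʳ-∣-∣ M (p * x) (s * N)) (*-distribʳ-∣-∣ N (s * M) (p * y)) ⟨
  ∣ p * x - s * N ∣ * M + ∣ s * M - p * y ∣ * N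
      ≤⟨ +-mono-≤ (*-monoˡ-≤ M hx) (*-monoˡ-≤ N (subst (_≤ p * c) (∣-∣-comm (p * y) (s * M)) hy)) ⟩
  p * c * M + p * c * N                           ≡⟨ collect p c N M ⟩
  p * (c * (N + M))                               ∎)
  where
  open ≤-Reasoning
  regroup : ∀ s N M → s * N * M ≡ s * M * N
  regroup = solve-∀
  collect : ∀ p c N M → p * c * M + p * c * N ≡ p * (c * (N + M))
  collect = solve-∀

x[N+M]≤NM-ordered : ∀ x {N M} → N ≤ M → 2 * x ≤ N → x * (N + M) ≤ N * M
x[N+M]≤NM-ordered x {N} {M} N≤M 2x≤N = begin
  x * (N + M) ≤⟨ *-monoʳ-≤ x (+-monoˡ-≤ M N≤M) ⟩
  x * (M + M) ≡⟨ double x M ⟩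
  2 * x * M   ≤⟨ *-monoˡ-≤ M 2x≤N ⟩
  N * M       ∎
  where
  open ≤-Reasoning
  double : ∀ x M → x * (M + M) ≡ 2 * x * M
  double = solve-∀

x[N+M]≤NM : ∀ x N M → 2 * x ≤ N → 2 * x ≤ M → x * (N + M) ≤ N * M
x[N+M]≤NM x N M 2x≤N 2x≤M with ≤-total N M
... | inj₁ N≤M = x[N+M]≤NM-ordered x N≤M 2x≤N
... | inj₂ M≤N = subst₂ _≤_ (cong (x *_) (+-comm M N)) (*-comm M N) (x[N+M]≤NM-ordered x M≤N 2x≤M)

Φ≡partialSum/ : ∀ e N .{{_ : NonZero N}} → Φ e N ≡ + partialSum e N ℚ./ N
Φ≡partialSum/ e (suc N) = refl

module _ (e : PotentialEvent) {p s c : ℕ} {{_ : NonZero p}}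
         (discrepancy : ∀ N → ∣ p * partialSum e N - s * N ∣ ≤ p * c) where

  Φ-cauchy : ∀ n N M .{{_ : NonZero n}} .{{_ : NonZero N}} .{{_ : NonZero M}} →
    2 * (c * n) ≤ N → 2 * (c * n) ≤ M → ℚ.∣ Φ e N ℚ.- Φ e M ∣ ℚ.≤ 1/ n
  Φ-cauchy n N M hN hM = subst₂ (λ x y → ℚ.∣ x ℚ.- y ∣ ℚ.≤ 1/ n) (sym (Φ≡partialSum/ e N)) (sym (Φ≡partialSum/ e M))
    (∣m/b-n/d∣≤k/f (partialSum e N) N (partialSum e M) M 1 n (begin
      ∣ partialSum e N * M - partialSum e M * N ∣ * n ≤⟨ *-monoˡ-≤ n (∣xM-yN∣≤c[N+M] p {s} (discrepancy N) (discrepancy M)) ⟩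
      c * (N + M) * n                             ≡⟨ *-comm (c * (N + M)) n ⟩
      n * (c * (N + M))                           ≡⟨ *-assoc n c (N + M) ⟨
      n * c * (N + M)                             ≡⟨ cong (_* (N + M)) (*-comm n c) ⟩
      c * n * (N + M)                             ≤⟨ x[N+M]≤NM (c * n) N M hN hM ⟩
      N * M                                       ≡⟨ *-identityˡ (N * M) ⟨
      1 * (N * M)                                 ∎))
    where open ≤-Reasoning

  Φ-limit : ∀ n N .{{_ : NonZero n}} .{{_ : NonZero N}} →
    c * n ≤ N → ℚ.∣ Φ e N ℚ.- + s ℚ./ p ∣ ℚ.≤ 2/ n
  Φ-limit n N hN = subst (λ x → ℚ.∣ x ℚ.- + s ℚ./ p ∣ ℚ.≤ 2/ n) (sym (Φ≡partialSum/ e N))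
    (∣m/b-n/d∣≤k/f (partialSum e N) N s p 2 n (begin
      ∣ partialSum e N * p - s * N ∣ * n ≡⟨ cong (λ x → ∣ x - s * N ∣ * n) (*-comm (partialSum e N) p) ⟩
      ∣ p * partialSum e N - s * N ∣ * n ≤⟨ *-monoˡ-≤ n (discrepancy N) ⟩
      p * c * n                          ≡⟨ *-assoc p c n ⟩
      p * (c * n)                        ≤⟨ *-monoʳ-≤ p hN ⟩
      p * N                              ≡⟨ *-comm p N ⟩
      N * p                              ≤⟨ m≤m+n (N * p) (N * p + 0) ⟩
      2 * (N * p)                        ∎))
    where open ≤-Reasoning

  module _ {{_ : NonZero c}} where

    private
      γ : ℕ → ℕ
      γ n = 2 * (c * n)

      γ-nonZero : IsSeqℕ⁺ γ
      γ-nonZero n = m*n≢0 2 (c * n)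
        where instance _ = m*n≢0 c n

      γ+-nonZero : ∀ n i .{{_ : NonZero n}} → NonZero (γ n + i)
      γ+-nonZero n i = >-nonZero (<-≤-trans (>-nonZero⁻¹ (γ n) {{γ-nonZero n}}) (m≤m+n (γ n) i))

      γ-increasing : StrictlyIncreasing γ
      γ-increasing n m n<m = *-monoʳ-< 2 (*-monoʳ-< c n<m)

    bounded-discrepancy⇒actual-event : Σ (ℕ → ℕ) λ γ → IsActualEvent e γ × (ℙ e γ =ℝ const (+ s ℚ./ p))
    bounded-discrepancy⇒actual-event = γ , (γ-nonZero , γ-increasing , cauchy) , limit
      where
      cauchy : ∀ n .{{_ : NonZero n}} i j → ℚ.∣ Φ e (γ n + i) ℚ.- Φ e (γ n + j) ∣ ℚ.≤ 1/ n
      cauchy n i j = Φ-cauchy n (γ n + i) (γ n + j) (m≤m+n (γ n) i) (m≤m+n (γ n) j)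
        where instance
          _ = γ+-nonZero n i
          _ = γ+-nonZero n j
      limit : ℙ e γ =ℝ const (+ s ℚ./ p)
      limit n = Φ-limit n (γ n) (m≤m+n (c * n) (c * n + 0))
        where instance _ = γ-nonZero n

eventually-periodic⇒actual-event :
  ∀ {a p} {{_ : NonZero p}} {e} → Periodic p (shift a e) →
  Σ (ℕ → ℕ) λ γ → IsActualEvent e γ × (ℙ e γ =ℝ const (+ partialSum (shift a e) p ℚ./ p))
eventually-periodic⇒actual-event {a} {p} {e} per =
  bounded-discrepancy⇒actual-event e {p} {partialSum (shift a e) p} {a + p} (eventually-periodic-discrepancy per)
  where instance _ = >-nonZero (≤-trans (>-nonZero⁻¹ p) (m≤n+m p a))

mainTheorem1 : (α π : List Bool) → (nz : NonZero (length π)) →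
    Σ (ℕ → ℕ) (λ γ → IsActualEvent (‖_,_‖ α π {{nz}}) γ ×
      (ℙ (‖_,_‖ α π {{nz}}) γ =ℝ const (average π {{nz}})))
mainTheorem1 α π nz =
  subst (λ s → Σ (ℕ → ℕ) λ γ → IsActualEvent ‖ α , π ‖ γ × (ℙ ‖ α , π ‖ γ =ℝ const (+ s ℚ./ length π)))
        (‖α,π‖-period-count α π)
        (eventually-periodic⇒actual-event {a = length α} (‖α,π‖-periodic α π))
  where instance _ = nz
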